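{- If $q$ is a prime power, $n$ is a positive integer and $M \cong \mathrm{PG}(n-1,q)$, then $\mathcal{T}_n(M)$ is a tangle of order $n$ in $M$.
   Context: $\lambda_M(X) = r_M(X) + r_M(E(M)-X) - r(M)$; $X$ is $k$-separating if $\lambda_M(X) < k$. For an integer $k$, $\mathcal{T}_k(M)$ is the collection of $(k-1)$-separating subsets of $E(M)$ that are neither spanning nor cospanning. A tangle of order $\theta$ on $M$ is a collection $\mathcal{T}$ of subsets of $E(M)$ such that: (1) every set in $\mathcal{T}$ is $(\theta-1)$-separating, and for each $(\theta-1)$-separating $X$, either $X \in \mathcal{T}$ or $E(M)-X \in \mathcal{T}$; (2) no three members of $\mathcal{T}$ have union $E(M)$; (3) $E(M)-\{e\} \notin \mathcal{T}$ for each $e \in E(M)$. -}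

module Defs where

open import Data.Nat using (ℕ; zero; suc; _+_; _∸_; _≤_; _<_; _^_)
open import Data.Nat.Primality using (Prime)
open import Data.Fin using (Fin)
import Data.Fin as Fin
open import Data.Fin.Subset using (Subset; _∩_; ∁; _∪_; ⊤; ⁅_⁆; ∣_∣; _⊆_; _∉_; _∈_)
open import Data.Product using (Σ; ∃; _×_; _,_)
open import Data.Sum using (_⊎_)
open import Relation.Nullary using (¬_)
open import Relation.Binary.PropositionalEquality using (_≡_)
open import Algebra.Structures using (IsCommutativeRing)

IsPrimePower : ℕ → Set
IsPrimePower q = Σ ℕ λ p → Σ ℕ λ k → Prime p × 1 ≤ k × q ≡ p ^ k

record FiniteField (q : ℕ) : Set where
  field
    _+F_ : Fin q → Fin q → Fin q
    _*F_ : Fin q → Fin q → Fin q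
    -F_  : Fin q → Fin q
    0#  : Fin q
    1#  : Fin q
    isCommutativeRing : IsCommutativeRing _≡_ _+F_ _*F_ -F_ 0# 1#
    0≢1 : ¬ (0# ≡ 1#)
    inverse : ∀ x → ¬ (x ≡ 0#) → Σ (Fin q) λ y → x *F y ≡ 1#

record Matroid : Set where
  field
    m : ℕ
    r : Subset m → ℕ
    r-bound : ∀ X → r X ≤ ∣ X ∣
    r-mono  : ∀ X Y → X ⊆ Y → r X ≤ r Y
    r-submod : ∀ X Y → r (X ∪ Y) + r (X ∩ Y) ≤ r X + r Y

module _ (M : Matroid) where
  open Matroid M

  E : Subset m
  E = ⊤

  rM : ℕ
  rM = r E

  conn : Subset m → ℕ
  conn X = (r X + r (∁ X)) ∸ rM

  Separating : ℕ → Subset m → Set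
  Separating k X = conn X < k

  Spanning : Subset m → Set
  Spanning X = r X ≡ rM

  r* : Subset m → ℕ
  r* X = (∣ X ∣ + r (∁ X)) ∸ rM

  -- X is cospanning if it is spanning in the dual M*
  Cospanning : Subset m → Set
  Cospanning X = r* X ≡ r* E

  𝒯 : ℕ → Subset m → Set
  𝒯 k X = Separating (k ∸ 1) X × ¬ Spanning X × ¬ Cospanning X

  record IsTangle (θ : ℕ) (T : Subset m → Set) : Set where
    field
      sep      : ∀ X → T X → Separating (θ ∸ 1) X
      choose   : ∀ X → Separating (θ ∸ 1) X → T X ⊎ T (∁ X)
      no-cover : ∀ X Y Z → T X → T Y → T Z → ¬ ((X ∪ Y) ∪ Z ≡ E)
      no-coatom : ∀ e → ¬ T (∁ ⁅ e ⁆)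

module _ {q : ℕ} (F : FiniteField q) where
  open FiniteField F

  sumF : (m : ℕ) → (Fin m → Fin q) → Fin q
  sumF zero    f = 0#
  sumF (suc m) f = f Fin.zero +F sumF m (λ i → f (Fin.suc i))

  Vector : ℕ → Set
  Vector n = Fin n → Fin q

  IsZeroVec : {n : ℕ} → Vector n → Set
  IsZeroVec w = ∀ i → w i ≡ 0#

  Parallel : {n : ℕ} → Vector n → Vector n → Set
  Parallel w u = ∃ λ a → ∀ i → w i ≡ a *F u i

  LinIndep : {m n : ℕ} → (Fin m → Vector n) → Subset m → Set
  LinIndep {m} v Y =
    (c : Fin m → Fin q) → (∀ e → e ∉ Y → c e ≡ 0#) →
    (∀ i → sumF m (λ e → c e *F v e i) ≡ 0#) → ∀ e → c e ≡ 0#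

  IsLinRank : {m n : ℕ} → (Fin m → Vector n) → Subset m → ℕ → Set
  IsLinRank v X k =
    (Σ _ λ Y → Y ⊆ X × LinIndep v Y × ∣ Y ∣ ≡ k) ×
    (∀ Y → Y ⊆ X → LinIndep v Y → ∣ Y ∣ ≤ k)

  -- v : E → F^n picks exactly one nonzero representative of each point of
  -- PG(n-1, F) (each 1-dimensional subspace of F^n)
  IsPGPoints : {m : ℕ} (n : ℕ) → (Fin m → Vector n) → Set
  IsPGPoints {m} n v =
    (∀ e → ¬ IsZeroVec (v e)) ×
    (∀ e f → Parallel (v e) (v f) → e ≡ f) ×
    (∀ (w : Vector n) → ¬ IsZeroVec w → ∃ λ e → Parallel w (v e))

-- M ≅ PG(n-1, F): M is the vector matroid of a set of representatives of
-- the points of PG(n-1, F).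
IsPG : (M : Matroid) (n : ℕ) {q : ℕ} (F : FiniteField q) → Set
IsPG M n F = Σ (Fin m → Vector F n) λ v →
  IsPGPoints F n v × (∀ X → IsLinRank F v X (r X))
  where open Matroid M

module Submission where

-- The proof separates the combinatorics of tangles from the linear algebra.
-- Write p ∈cl S when adding p to S does not raise the rank.  The only
-- geometric facts used about M = PG(n-1,q) are:
--   (simple) two distinct points have rank 2;
--   (thick)  every line has a third point: for e ≠ f there is g ∉ {e,f}
--            with r{e,f,g} ≤ 2, so any two of e,f,g span the third;
--   (rank)   r(M) ≥ n.
-- From these alone (module ThickMatroid) a non-spanning set X has a spanning
-- complement, hence λ(X) = r(X); so 𝒯_n(M) consists exactly of the sets of
-- rank < n-1, one of X, E-X has small rank whenever λ(X) < n-1, a union of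
-- three small-rank sets misses a point (found by walking along two lines),
-- and E-{e} is not in 𝒯_n(M), as otherwise {e} would span M.

open import Defs
open import Data.Nat using (ℕ; zero; suc; _+_; _∸_; _≤_; _<_; z≤n; s≤s; _≤?_; _<?_)
open import Data.Nat.Properties
  using ( ≤-reflexive; ≤-trans; ≤-antisym; <-≤-trans; ≤-<-trans; <⇒≢; <⇒≱; ≮⇒≥; ≰⇒>; ≤∧≢⇒<
        ; ≤-pred; n≤1+n; m≤m+n; m∸n≤m; n≤0⇒n≡0; n∸n≡0; m+n∸n≡m; m+n∸m≡n; m∸[m∸n]≡n
        ; +-suc; +-mono-≤; +-monoʳ-≤; +-cancelʳ-≤; module ≤-Reasoning)
  renaming (+-comm to ℕ+-comm; +-identityʳ to ℕ+-identityʳ)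
open import Data.Fin using (Fin; _≟_)
import Data.Fin as Fin
open import Data.Fin.Properties using (suc-injective; ¬∀⟶∃¬)
open import Data.Fin.Subset hiding (⊥)
import Data.Fin.Subset as Sub
open import Data.Fin.Subset.Properties
open import Data.Vec using (_∷_; [])
open import Data.Bool using (if_then_else_)
open import Data.Product using (∃; _×_; _,_; proj₁; proj₂)
open import Data.Sum using (_⊎_; inj₁; inj₂; [_,_]′)
open import Data.Empty using (⊥-elim)
open import Function using (_∘_)
open import Relation.Nullary using (¬_; Dec; yes; no; does)
open import Relation.Nullary.Decidable using (dec-true; dec-false)
open import Relation.Binary.PropositionalEquality
open import Algebra.Bundles using (Ring)
open import Algebra.Structures using (IsCommutativeRing)
import Algebra.Properties.Ring as RingProperties
import Algebra.Properties.Group as GroupProperties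

private
  variable
    k : ℕ
    x y : Fin k
    A B C : Subset k

∈∪ˡ : x ∈ A → x ∈ A ∪ B
∈∪ˡ x∈A = x∈p∪q⁺ (inj₁ x∈A)

∈∪ʳ : x ∈ B → x ∈ A ∪ B
∈∪ʳ x∈B = x∈p∪q⁺ (inj₂ x∈B)

∪-least : A ⊆ C → B ⊆ C → A ∪ B ⊆ C
∪-least {A = A} {B = B} A⊆C B⊆C x∈A∪B = [ A⊆C , B⊆C ]′ (x∈p∪q⁻ A B x∈A∪B)

∈⁅⁆⇒≡ : x ∈ ⁅ y ⁆ → x ≡ y
∈⁅⁆⇒≡ {y = y} = x∈⁅y⁆⇒x≡y y

cover-middle : (A ∪ B) ∪ C ≡ ⊤ → x ∉ A → x ∉ C → x ∈ B
cover-middle {A = A} {B = B} {C = C} {x = x} cover x∉A x∉C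
  with x∈p∪q⁻ (A ∪ B) C (subst (x ∈_) (sym cover) ∈⊤)
... | inj₂ x∈C = ⊥-elim (x∉C x∈C)
... | inj₁ x∈A∪B = [ (λ x∈A → ⊥-elim (x∉A x∈A)) , (λ x∈B → x∈B) ]′ (x∈p∪q⁻ A B x∈A∪B)

∣p∪q∣≤∣p∣+∣q∣ : (p q : Subset k) → ∣ p ∪ q ∣ ≤ ∣ p ∣ + ∣ q ∣
∣p∪q∣≤∣p∣+∣q∣ []            []            = z≤n
∣p∪q∣≤∣p∣+∣q∣ (inside ∷ p)  (inside ∷ q)  = s≤s (≤-trans (∣p∪q∣≤∣p∣+∣q∣ p q) (+-monoʳ-≤ ∣ p ∣ (n≤1+n _)))
∣p∪q∣≤∣p∣+∣q∣ (inside ∷ p)  (outside ∷ q) = s≤s (∣p∪q∣≤∣p∣+∣q∣ p q)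
∣p∪q∣≤∣p∣+∣q∣ (outside ∷ p) (inside ∷ q)  = ≤-trans (s≤s (∣p∪q∣≤∣p∣+∣q∣ p q)) (≤-reflexive (sym (+-suc _ _)))
∣p∪q∣≤∣p∣+∣q∣ (outside ∷ p) (outside ∷ q) = ∣p∪q∣≤∣p∣+∣q∣ p q

∣pair∣≥2 : (x y : Fin k) → x ≢ y → 2 ≤ ∣ ⁅ x ⁆ ∪ ⁅ y ⁆ ∣
∣pair∣≥2 x y x≢y = subst (λ c → suc c ≤ ∣ ⁅ x ⁆ ∪ ⁅ y ⁆ ∣) (∣⁅x⁆∣≡1 x)
  (p⊂q⇒∣p∣<∣q∣ (∈∪ˡ , y , ∈∪ʳ (x∈⁅x⁆ y) , x≢y⇒x∉⁅y⁆ (≢-sym x≢y)))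

Tri : Fin k → Fin k → Fin k → Subset k
Tri e f g = ⁅ e ⁆ ∪ (⁅ f ⁆ ∪ ⁅ g ⁆)

module _ {e f g : Fin k} where
  e∈Tri : e ∈ Tri e f g
  e∈Tri = ∈∪ˡ (x∈⁅x⁆ e)

  f∈Tri : f ∈ Tri e f g
  f∈Tri = ∈∪ʳ (∈∪ˡ (x∈⁅x⁆ f))

  g∈Tri : g ∈ Tri e f g
  g∈Tri = ∈∪ʳ (∈∪ʳ (x∈⁅x⁆ g))

  ∣Tri∣≤3 : ∣ Tri e f g ∣ ≤ 3
  ∣Tri∣≤3 = ≤-trans (∣p∪q∣≤∣p∣+∣q∣ ⁅ e ⁆ _)
    (+-mono-≤ (≤-reflexive (∣⁅x⁆∣≡1 e))
              (≤-trans (∣p∪q∣≤∣p∣+∣q∣ ⁅ f ⁆ ⁅ g ⁆) (≤-reflexive (cong₂ _+_ (∣⁅x⁆∣≡1 f) (∣⁅x⁆∣≡1 g)))))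

⊆-full : A ⊆ B → ∣ B ∣ ≤ ∣ A ∣ → x ∈ B → x ∈ A
⊆-full {A = A} {x = x} A⊆B ∣B∣≤∣A∣ x∈B with x ∈? A
... | yes x∈A = x∈A
... | no x∉A = ⊥-elim (<⇒≱ (p⊂q⇒∣p∣<∣q∣ (A⊆B , x , x∈B , x∉A)) ∣B∣≤∣A∣)

Im : ∀ {j₀} → (Fin j₀ → Fin k) → Subset k
Im {j₀ = zero}   p = Sub.⊥
Im {j₀ = suc j₀} p = ⁅ p Fin.zero ⁆ ∪ Im (p ∘ Fin.suc)

Im-intro : ∀ {j₀} (p : Fin j₀ → Fin k) j → p j ∈ Im p
Im-intro p Fin.zero    = ∈∪ˡ (x∈⁅x⁆ (p Fin.zero))
Im-intro p (Fin.suc j) = ∈∪ʳ (Im-intro (p ∘ Fin.suc) j)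

Im-elim : ∀ {j₀} (p : Fin j₀ → Fin k) → x ∈ Im p → ∃ λ j → x ≡ p j
Im-elim {j₀ = zero}   p x∈ = ⊥-elim (∉⊥ x∈)
Im-elim {j₀ = suc j₀} p x∈ with x∈p∪q⁻ ⁅ p Fin.zero ⁆ (Im (p ∘ Fin.suc)) x∈
... | inj₁ x∈hd = Fin.zero , ∈⁅⁆⇒≡ x∈hd
... | inj₂ x∈tl with Im-elim (p ∘ Fin.suc) x∈tl
...   | j , x≡pj = Fin.suc j , x≡pj

Im-size : ∀ {j₀} (p : Fin j₀ → Fin k) → (∀ i j → p i ≡ p j → i ≡ j) → j₀ ≤ ∣ Im p ∣
Im-size {j₀ = zero}   p inj = z≤n
Im-size {j₀ = suc j₀} p inj =
  ≤-trans (s≤s (Im-size (p ∘ Fin.suc) (λ i j eq → suc-injective (inj _ _ eq))))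
          (p⊂q⇒∣p∣<∣q∣ (∈∪ʳ , p Fin.zero , ∈∪ˡ (x∈⁅x⁆ _) , head∉tail))
  where
  head∉tail : p Fin.zero ∉ Im (p ∘ Fin.suc)
  head∉tail x∈ with Im-elim (p ∘ Fin.suc) x∈
  ... | j , eq with inj _ _ eq
  ...   | ()

<∸1⇒suc< : ∀ {a b c} → a < b ∸ 1 → b ≤ c → suc a < c
<∸1⇒suc< {b = zero}  ()
<∸1⇒suc< {b = suc b} a<b b≤c = <-≤-trans (s≤s a<b) b≤c

module Closure (M : Matroid) where
  open Matroid M

  _∈cl_ : Fin m → Subset m → Set
  p ∈cl S = r (S ∪ ⁅ p ⁆) ≤ r S

  _∈cl?_ : ∀ p S → Dec (p ∈cl S)
  p ∈cl? S = r (S ∪ ⁅ p ⁆) ≤? r S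

  r≤rM : ∀ X → r X ≤ rM M
  r≤rM X = r-mono X ⊤ ⊆⊤

  rM≤m : rM M ≤ m
  rM≤m = ≤-trans (r-bound ⊤) (≤-reflexive (∣⊤∣≡n m))

  r∁⊤≡0 : r (∁ ⊤) ≡ 0
  r∁⊤≡0 = n≤0⇒n≡0 (≤-trans (r-bound _)
    (≤-reflexive (trans (∣∁p∣≡n∸∣p∣ (⊤ {m})) (trans (cong (m ∸_) (∣⊤∣≡n m)) (n∸n≡0 m)))))

  ∈⇒∈cl : ∀ {p S} → p ∈ S → p ∈cl S
  ∈⇒∈cl {p} {S} p∈S = r-mono _ _ (∪-least (λ q∈S → q∈S) (λ q∈p → subst (_∈ S) (sym (∈⁅⁆⇒≡ q∈p)) p∈S))

  ∉cl⇒∉ : ∀ {p S} → ¬ p ∈cl S → p ∉ S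
  ∉cl⇒∉ p∉clS = p∉clS ∘ ∈⇒∈cl

  rank-add-point : ∀ S p → r (S ∪ ⁅ p ⁆) ≤ suc (r S)
  rank-add-point S p = begin
    r (S ∪ ⁅ p ⁆)                   ≤⟨ m≤m+n _ (r (S ∩ ⁅ p ⁆)) ⟩
    r (S ∪ ⁅ p ⁆) + r (S ∩ ⁅ p ⁆)  ≤⟨ r-submod S ⁅ p ⁆ ⟩
    r S + r ⁅ p ⁆                   ≤⟨ +-monoʳ-≤ (r S) (≤-trans (r-bound _) (≤-reflexive (∣⁅x⁆∣≡1 p))) ⟩
    r S + 1                         ≡⟨ ℕ+-comm (r S) 1 ⟩
    suc (r S)                       ∎
    where open ≤-Reasoning

  union-same-rank : ∀ {S X Y} → S ⊆ X → S ⊆ Y → r X ≤ r S → r Y ≤ r S → r (X ∪ Y) ≤ r S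
  union-same-rank {S} {X} {Y} S⊆X S⊆Y rX≤rS rY≤rS = +-cancelʳ-≤ (r S) (r (X ∪ Y)) (r S) (begin
    r (X ∪ Y) + r S         ≤⟨ +-monoʳ-≤ (r (X ∪ Y)) (r-mono S (X ∩ Y) (λ p∈S → x∈p∩q⁺ (S⊆X p∈S , S⊆Y p∈S))) ⟩
    r (X ∪ Y) + r (X ∩ Y)   ≤⟨ r-submod X Y ⟩
    r X + r Y               ≤⟨ +-mono-≤ rX≤rS rY≤rS ⟩
    r S + r S               ∎)
    where open ≤-Reasoning

  add-closure-points : ∀ S {j₀} (p : Fin j₀ → Fin m) → (∀ j → p j ∈cl S) → r (S ∪ Im p) ≤ r S
  add-closure-points S {zero}   p p∈cl = r-mono _ _ (∪-least (λ q∈S → q∈S) (⊥-elim ∘ ∉⊥))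
  add-closure-points S {suc j₀} p p∈cl =
    ≤-trans (r-mono _ _ (∪-least (∈∪ˡ ∘ ∈∪ˡ) (∪-least (∈∪ʳ ∘ ∈∪ʳ) (∈∪ˡ ∘ ∈∪ʳ))))
            (union-same-rank (p⊆p∪q _) (p⊆p∪q _)
               (add-closure-points S (p ∘ Fin.suc) (p∈cl ∘ Fin.suc)) (p∈cl Fin.zero))

  all-in-closure⇒spanning : ∀ S → (∀ p → p ∈cl S) → Spanning M S
  all-in-closure⇒spanning S p∈cl = ≤-antisym (r≤rM S)
    (≤-trans (r-mono ⊤ _ (λ {p} _ → ∈∪ʳ (Im-intro (λ q → q) p)))
             (add-closure-points S (λ q → q) p∈cl))

  rank<⇒point-outside-closure : ∀ S → r S < rM M → ∃ λ p → ¬ p ∈cl S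
  rank<⇒point-outside-closure S rS<rM =
    ¬∀⟶∃¬ m (_∈cl S) (_∈cl? S) (λ all → <⇒≢ rS<rM (all-in-closure⇒spanning S all))

  closure-point⇒dependent : ∀ S p → p ∈ S → p ∈cl (S - p) → r S < ∣ S ∣
  closure-point⇒dependent S p p∈S p∈cl = begin-strict
    r S                   ≤⟨ r-mono _ _ S⊆ ⟩
    r ((S - p) ∪ ⁅ p ⁆)   ≤⟨ p∈cl ⟩
    r (S - p)             ≤⟨ r-bound _ ⟩
    ∣ S - p ∣             <⟨ x∈p⇒∣p-x∣<∣p∣ p∈S ⟩
    ∣ S ∣                 ∎
    where
    open ≤-Reasoning
    S⊆ : S ⊆ (S - p) ∪ ⁅ p ⁆
    S⊆ {q} q∈S with q ≟ p
    ... | yes q≡p = ∈∪ʳ (subst (_∈ ⁅ p ⁆) (sym q≡p) (x∈⁅x⁆ p))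
    ... | no q≢p  = ∈∪ˡ (x∈p∧x≢y⇒x∈p-y q∈S q≢p)

  rank-two-closure : ∀ {S T x y z} → r T ≤ 2 → 2 ≤ r (⁅ x ⁆ ∪ ⁅ y ⁆) →
                     x ∈ T → y ∈ T → z ∈ T → x ∈ S → y ∈ S → z ∈cl S
  rank-two-closure {S} {T} {x} {y} {z} rT≤2 2≤rxy x∈T y∈T z∈T x∈S y∈S = +-cancelʳ-≤ 2 _ _ (begin
    r (S ∪ ⁅ z ⁆) + 2          ≤⟨ +-mono-≤ (r-mono _ _ (∪-least ∈∪ˡ (λ q∈z → ∈∪ʳ (∈single z∈T q∈z))))
                                           (≤-trans 2≤rxy (r-mono _ _ (∪-least (both x∈S x∈T) (both y∈S y∈T)))) ⟩
    r (S ∪ T) + r (S ∩ T)      ≤⟨ r-submod S T ⟩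
    r S + r T                  ≤⟨ +-monoʳ-≤ (r S) rT≤2 ⟩
    r S + 2                    ∎)
    where
    open ≤-Reasoning
    ∈single : ∀ {a b U} → a ∈ U → b ∈ ⁅ a ⁆ → b ∈ U
    ∈single {U = U} a∈U b∈a = subst (_∈ U) (sym (∈⁅⁆⇒≡ b∈a)) a∈U
    both : ∀ {a} → a ∈ S → a ∈ T → ⁅ a ⁆ ⊆ S ∩ T
    both a∈S a∈T b∈a = x∈p∩q⁺ (∈single a∈S b∈a , ∈single a∈T b∈a)

  rank-two-closure′ : ∀ {S T x y z} → r T ≤ 2 → 2 ≤ r (⁅ x ⁆ ∪ ⁅ y ⁆) →
                      x ∈ T → y ∈ T → z ∈ T → x ∈cl S → y ∈cl S → z ∈cl S
  rank-two-closure′ {S} {T} {x} {y} {z} rT≤2 2≤rxy x∈T y∈T z∈T x∈clS y∈clS =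
    ≤-trans (r-mono _ (S⁺ ∪ ⁅ z ⁆) (∪-least (∈∪ˡ ∘ ∈∪ˡ ∘ ∈∪ˡ) ∈∪ʳ))
            (≤-trans (rank-two-closure rT≤2 2≤rxy x∈T y∈T z∈T (∈∪ˡ (∈∪ʳ (x∈⁅x⁆ x))) (∈∪ʳ (∈∪ʳ (x∈⁅x⁆ y))))
                     (union-same-rank (p⊆p∪q _) (p⊆p∪q _) x∈clS y∈clS))
    where
    S⁺ : Subset m
    S⁺ = (S ∪ ⁅ x ⁆) ∪ (S ∪ ⁅ y ⁆)

record ThirdPoint (M : Matroid) (e f : Fin (Matroid.m M)) : Set where
  field
    point : Fin (Matroid.m M)
    e≢f : e ≢ f
    point≢e : point ≢ e
    point≢f : point ≢ f
    collinear : Matroid.r M (Tri e f point) ≤ 2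

module ThickMatroid (M : Matroid) (n : ℕ)
  (simple : ∀ x y → x ≢ y → 2 ≤ Matroid.r M (⁅ x ⁆ ∪ ⁅ y ⁆))
  (thick : ∀ e f → e ≢ f → ThirdPoint M e f)
  (n≤R : n ≤ rM M) where

  open Matroid M
  open Closure M
  open ThirdPoint using (point)

  R : ℕ
  R = rM M

  module _ {e f} (L : ThirdPoint M e f) {S : Subset m} where
    open ThirdPoint L renaming (point to g; point≢e to g≢e; point≢f to g≢f)

    line-cl-g : e ∈cl S → f ∈cl S → g ∈cl S
    line-cl-g = rank-two-closure′ collinear (simple e f e≢f) e∈Tri f∈Tri g∈Tri

    line-cl-f : e ∈cl S → g ∈cl S → f ∈cl S
    line-cl-f = rank-two-closure′ collinear (simple e g (≢-sym g≢e)) e∈Tri g∈Tri f∈Tri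

    line-cl-e : f ∈cl S → g ∈cl S → e ∈cl S
    line-cl-e = rank-two-closure′ collinear (simple f g (≢-sym g≢f)) f∈Tri g∈Tri e∈Tri

  nonspanning⇒rank<R : ∀ {X} → ¬ Spanning M X → r X < R
  nonspanning⇒rank<R = ≤∧≢⇒< (r≤rM _)

  rank≮R⇒spanning : ∀ {X} → ¬ r X < R → Spanning M X
  rank≮R⇒spanning rX≮R = ≤-antisym (r≤rM _) (≮⇒≥ rX≮R)

  -- The complement of a non-spanning set X is spanning: with e outside cl X,
  -- every f ∈ X lies on a line through e whose third point is outside X.
  complement-spans : ∀ X → r X < R → Spanning M (∁ X)
  complement-spans X rX<R with rank<⇒point-outside-closure X rX<R
  ... | e , e∉clX = all-in-closure⇒spanning (∁ X) in-closure
    where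
    e∉X : e ∉ X
    e∉X = ∉cl⇒∉ e∉clX
    in-closure : ∀ f → f ∈cl ∁ X
    in-closure f with f ∈? X
    ... | no f∉X = ∈⇒∈cl (x∉p⇒x∈∁p f∉X)
    ... | yes f∈X = line-cl-f L (∈⇒∈cl (x∉p⇒x∈∁p e∉X)) (∈⇒∈cl (x∉p⇒x∈∁p g∉X))
      where
      L : ThirdPoint M e f
      L = thick e f (λ e≡f → e∉X (subst (_∈ X) (sym e≡f) f∈X))
      g∉X : point L ∉ X
      g∉X g∈X = e∉clX (line-cl-e L (∈⇒∈cl f∈X) (∈⇒∈cl g∈X))

  conn-nonspanning : ∀ X → r X < R → conn M X ≡ r X
  conn-nonspanning X rX<R =
    trans (cong (λ s → (r X + s) ∸ R) (complement-spans X rX<R)) (m+n∸n≡m (r X) R)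

  -- No two non-spanning sets have closures covering M: take u ∉ cl A, w ∉ cl B;
  -- if neither works for both, the third point of the line uw does.
  avoid-two-flats : ∀ A B → r A < R → r B < R → ∃ λ p → ¬ p ∈cl A × ¬ p ∈cl B
  avoid-two-flats A B rA<R rB<R
    with rank<⇒point-outside-closure A rA<R | rank<⇒point-outside-closure B rB<R
  ... | u , u∉clA | w , w∉clB with u ∈cl? B | w ∈cl? A
  ... | no u∉clB | _         = u , u∉clA , u∉clB
  ... | yes _    | no w∉clA  = w , w∉clA , w∉clB
  ... | yes u∈clB | yes w∈clA =
    point L , (λ g∈clA → u∉clA (line-cl-e L w∈clA g∈clA))
            , (λ g∈clB → w∉clB (line-cl-f L u∈clB g∈clB))
    where
    L : ThirdPoint M u w
    L = thick u w (λ u≡w → u∉clA (subst (_∈cl A) (sym u≡w) w∈clA))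

  -- The complement of a set of rank at most r(M) - 2 contains a whole line
  -- {e, e', g} (e ∉ cl X, e' ∉ cl (X ∪ e)), so it is dependent.
  complement-dependent : ∀ X → suc (r X) < R → r (∁ X) < ∣ ∁ X ∣
  complement-dependent X rX+1<R with rank<⇒point-outside-closure X (≤-<-trans (n≤1+n _) rX+1<R)
  ... | e , e∉clX with rank<⇒point-outside-closure (X ∪ ⁅ e ⁆) (≤-<-trans (rank-add-point X e) rX+1<R)
  ...   | e′ , e′∉clXe = closure-point⇒dependent (∁ X) g (x∉p⇒x∈∁p g∉X)
            (line-cl-g L (∈⇒∈cl (in-∁X-g e∉X (g≢e ∘ sym))) (∈⇒∈cl (in-∁X-g e′∉X (g≢e′ ∘ sym))))
    where
    open ThirdPoint using (point≢e; point≢f)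
    e∈Xe : e ∈cl (X ∪ ⁅ e ⁆)
    e∈Xe = ∈⇒∈cl (∈∪ʳ (x∈⁅x⁆ e))
    L : ThirdPoint M e e′
    L = thick e e′ (λ e≡e′ → e′∉clXe (subst (_∈cl (X ∪ ⁅ e ⁆)) e≡e′ e∈Xe))
    g : Fin m
    g = point L
    g≢e : g ≢ e
    g≢e = point≢e L
    g≢e′ : g ≢ e′
    g≢e′ = point≢f L
    e∉X : e ∉ X
    e∉X = ∉cl⇒∉ e∉clX
    e′∉X : e′ ∉ X
    e′∉X = ∉cl⇒∉ e′∉clXe ∘ ∈∪ˡ
    g∉X : g ∉ X
    g∉X g∈X = e′∉clXe (line-cl-f L e∈Xe (∈⇒∈cl (∈∪ˡ g∈X)))
    in-∁X-g : ∀ {p} → p ∉ X → p ≢ g → p ∈ ∁ X - g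
    in-∁X-g p∉X p≢g = x∈p∧x≢y⇒x∈p-y (x∉p⇒x∈∁p p∉X) p≢g

  cospanning⇒∣∁X∣≡R : ∀ X → r X < R → Cospanning M X → ∣ ∁ X ∣ ≡ R
  cospanning⇒∣∁X∣≡R X rX<R cosp = begin
    ∣ ∁ X ∣        ≡⟨ ∣∁p∣≡n∸∣p∣ X ⟩
    m ∸ ∣ X ∣      ≡⟨ cong (m ∸_) ∣X∣≡m∸R ⟩
    m ∸ (m ∸ R)    ≡⟨ m∸[m∸n]≡n rM≤m ⟩
    R              ∎
    where
    open ≡-Reasoning
    r*X≡∣X∣ : r* M X ≡ ∣ X ∣
    r*X≡∣X∣ = trans (cong (λ s → (∣ X ∣ + s) ∸ R) (complement-spans X rX<R)) (m+n∸n≡m _ R)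
    r*E≡m∸R : r* M ⊤ ≡ m ∸ R
    r*E≡m∸R = cong (_∸ R) (trans (cong₂ _+_ (∣⊤∣≡n m) r∁⊤≡0) (ℕ+-identityʳ m))
    ∣X∣≡m∸R : ∣ X ∣ ≡ m ∸ R
    ∣X∣≡m∸R = trans (sym r*X≡∣X∣) (trans cosp r*E≡m∸R)

  small⇒𝒯 : ∀ X → r X < n ∸ 1 → 𝒯 M n X
  small⇒𝒯 X rX<n-1 =
    subst (_< n ∸ 1) (sym (conn-nonspanning X rX<R)) rX<n-1 ,
    <⇒≢ rX<R ,
    (λ cosp → <⇒≢ (complement-dependent X rX+1<R)
                 (trans (complement-spans X rX<R) (sym (cospanning⇒∣∁X∣≡R X rX<R cosp))))
    where
    rX+1<R : suc (r X) < R
    rX+1<R = <∸1⇒suc< rX<n-1 n≤R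
    rX<R : r X < R
    rX<R = ≤-<-trans (n≤1+n _) rX+1<R

  𝒯⇒rank<R : ∀ {X} → 𝒯 M n X → r X < R
  𝒯⇒rank<R (_ , nonspanning , _) = nonspanning⇒rank<R nonspanning

  𝒯⇒small : ∀ {X} → 𝒯 M n X → r X < n ∸ 1
  𝒯⇒small {X} t@(sep , _ , _) = subst (_< n ∸ 1) (conn-nonspanning X (𝒯⇒rank<R t)) sep

  𝒯⇒rank+point<R : ∀ {X} e → 𝒯 M n X → r (X ∪ ⁅ e ⁆) < R
  𝒯⇒rank+point<R {X} e t = ≤-<-trans (rank-add-point X e) (<∸1⇒suc< (𝒯⇒small t) n≤R)

  -- Tangle axiom (1): if X is non-spanning then λ(X) = r(X), and if X spans
  -- but E - X does not then λ(X) = r(E - X); both cannot span, as then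
  -- λ(X) = r(M) ≥ n.
  choose : ∀ X → Separating M (n ∸ 1) X → 𝒯 M n X ⊎ 𝒯 M n (∁ X)
  choose X sep with r X <? R | r (∁ X) <? R
  ... | yes rX<R | _ = inj₁ (small⇒𝒯 X (subst (_< n ∸ 1) (conn-nonspanning X rX<R) sep))
  ... | no rX≮R | yes _ = inj₂ (small⇒𝒯 (∁ X) (subst (_< n ∸ 1) conn≡r∁X sep))
    where
    conn≡r∁X : conn M X ≡ r (∁ X)
    conn≡r∁X = trans (cong (λ s → (s + r (∁ X)) ∸ R) (rank≮R⇒spanning rX≮R)) (m+n∸m≡n R _)
  ... | no rX≮R | no r∁X≮R = ⊥-elim (<⇒≱ sep (≤-trans (m∸n≤m n 1) (≤-trans n≤R (≤-reflexive (sym conn≡R)))))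
    where
    conn≡R : conn M X ≡ R
    conn≡R = trans (cong₂ (λ a b → (a + b) ∸ R) (rank≮R⇒spanning rX≮R) (rank≮R⇒spanning r∁X≮R))
                   (m+n∸n≡m R R)

  -- Tangle axiom (2): pick e outside cl X ∪ cl Y.  If e ∉ Z it is uncovered;
  -- otherwise pick f outside cl (X ∪ e) ∪ cl Z.  Then f and the third point g
  -- of the line ef avoid X and Z, so both lie in Y, forcing e ∈ cl Y.
  no-cover : ∀ X Y Z → 𝒯 M n X → 𝒯 M n Y → 𝒯 M n Z → ¬ ((X ∪ Y) ∪ Z ≡ E M)
  no-cover X Y Z tX tY tZ cover with avoid-two-flats X Y (𝒯⇒rank<R tX) (𝒯⇒rank<R tY)
  ... | e , e∉clX , e∉clY with e ∈cl? Z
  ...   | no e∉clZ = e∉clY (∈⇒∈cl (cover-middle cover (∉cl⇒∉ e∉clX) (∉cl⇒∉ e∉clZ)))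
  ...   | yes e∈clZ with avoid-two-flats (X ∪ ⁅ e ⁆) Z (𝒯⇒rank+point<R e tX) (𝒯⇒rank<R tZ)
  ...     | f , f∉clXe , f∉clZ = e∉clY (line-cl-e L (∈⇒∈cl f∈Y) (∈⇒∈cl g∈Y))
    where
    e∈clXe : e ∈cl (X ∪ ⁅ e ⁆)
    e∈clXe = ∈⇒∈cl (∈∪ʳ (x∈⁅x⁆ e))
    L : ThirdPoint M e f
    L = thick e f (λ e≡f → f∉clXe (subst (_∈cl (X ∪ ⁅ e ⁆)) e≡f e∈clXe))
    f∈Y : f ∈ Y
    f∈Y = cover-middle cover (∉cl⇒∉ f∉clXe ∘ ∈∪ˡ) (∉cl⇒∉ f∉clZ)
    g∈Y : point L ∈ Y
    g∈Y = cover-middle cover (λ g∈X → f∉clXe (line-cl-f L e∈clXe (∈⇒∈cl (∈∪ˡ g∈X))))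
                             (λ g∈Z → f∉clZ (line-cl-f L e∈clZ (∈⇒∈cl g∈Z)))

  -- Tangle axiom (3): if E - e were not spanning, {e} would be spanning, so
  -- r(M) ≤ 1; but λ(E - e) < n - 1 forces r(M) ≥ n ≥ 2.
  no-coatom : ∀ e → ¬ 𝒯 M n (∁ ⁅ e ⁆)
  no-coatom e (sep , nonspanning , _) = <⇒≱ (≤-<-trans (s≤s z≤n) (<∸1⇒suc< sep n≤R)) R≤1
    where
    open ≤-Reasoning
    R≤1 : R ≤ 1
    R≤1 = begin
      R                   ≡⟨ sym (complement-spans _ (nonspanning⇒rank<R nonspanning)) ⟩
      r (∁ (∁ ⁅ e ⁆))     ≤⟨ r-mono _ _ (x∉∁p⇒x∈p ∘ x∈∁p⇒x∉p) ⟩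
      r ⁅ e ⁆             ≤⟨ r-bound _ ⟩
      ∣ ⁅ e ⁆ ∣           ≡⟨ ∣⁅x⁆∣≡1 e ⟩
      1                   ∎

  tangle : IsTangle M n (𝒯 M n)
  tangle = record
    { sep = λ _ → proj₁
    ; choose = choose
    ; no-cover = no-cover
    ; no-coatom = no-coatom
    }

module FieldFacts {q : ℕ} (F : FiniteField q) where
  open FiniteField F public
  open IsCommutativeRing isCommutativeRing public
    using ( +-assoc; +-comm; +-identityˡ; +-identityʳ; -‿inverseʳ
          ; *-assoc; *-comm; *-identityˡ; distribʳ; zeroˡ; zeroʳ; isRing)
  open ≡-Reasoning

  ring : Ring _ _
  ring = record { isRing = isRing }

  open RingProperties ring public using (-‿distribˡ-*; -‿distribʳ-*; -1*x≈-x)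
  open GroupProperties (Ring.+-group ring) public using (inverseˡ-unique)

  nonzero-cancel : ∀ a b → a ≢ 0# → a *F b ≡ 0# → b ≡ 0#
  nonzero-cancel a b a≢0 ab≡0 with inverse a a≢0
  ... | a⁻¹ , aa⁻¹≡1 = begin
    b                  ≡⟨ sym (*-identityˡ b) ⟩
    1# *F b            ≡⟨ cong (_*F b) (trans (sym aa⁻¹≡1) (*-comm a a⁻¹)) ⟩
    (a⁻¹ *F a) *F b    ≡⟨ *-assoc a⁻¹ a b ⟩
    a⁻¹ *F (a *F b)    ≡⟨ cong (a⁻¹ *F_) ab≡0 ⟩
    a⁻¹ *F 0#          ≡⟨ zeroʳ a⁻¹ ⟩
    0#                 ∎

  solve-summand : ∀ s t a → s +F t ≡ a *F s → t ≡ (a +F (-F 1#)) *F s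
  solve-summand s t a s+t≡as = sym (begin
    (a +F (-F 1#)) *F s        ≡⟨ distribʳ s a (-F 1#) ⟩
    (a *F s) +F ((-F 1#) *F s) ≡⟨ cong ((a *F s) +F_) (-1*x≈-x s) ⟩
    (a *F s) +F (-F s)         ≡⟨ cong (_+F (-F s)) (trans (sym s+t≡as) (+-comm s t)) ⟩
    (t +F s) +F (-F s)         ≡⟨ +-assoc t s (-F s) ⟩
    t +F (s +F (-F s))         ≡⟨ cong (t +F_) (-‿inverseʳ s) ⟩
    t +F 0#                    ≡⟨ +-identityʳ t ⟩
    t                          ∎)

  relation⇒parallel : ∀ {n} (u w : Vector F n) a b → a ≢ 0# →
                      (∀ i → (a *F u i) +F (b *F w i) ≡ 0#) → Parallel F u w
  relation⇒parallel u w a b a≢0 rel with inverse a a≢0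
  ... | a⁻¹ , aa⁻¹≡1 = -F (a⁻¹ *F b) , λ i → begin
    u i                        ≡⟨ sym (*-identityˡ (u i)) ⟩
    1# *F u i                  ≡⟨ cong (_*F u i) (trans (sym aa⁻¹≡1) (*-comm a a⁻¹)) ⟩
    (a⁻¹ *F a) *F u i          ≡⟨ *-assoc a⁻¹ a (u i) ⟩
    a⁻¹ *F (a *F u i)          ≡⟨ cong (a⁻¹ *F_) (inverseˡ-unique _ _ (rel i)) ⟩
    a⁻¹ *F (-F (b *F w i))     ≡⟨ sym (-‿distribʳ-* a⁻¹ _) ⟩
    -F (a⁻¹ *F (b *F w i))     ≡⟨ cong -F_ (sym (*-assoc a⁻¹ b (w i))) ⟩
    -F ((a⁻¹ *F b) *F w i)     ≡⟨ -‿distribˡ-* _ _ ⟩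
    (-F (a⁻¹ *F b)) *F w i     ∎

  Σ : (k : ℕ) → (Fin k → Fin q) → Fin q
  Σ = sumF F

  Σ-cong : ∀ k {f g : Fin k → Fin q} → (∀ z → f z ≡ g z) → Σ k f ≡ Σ k g
  Σ-cong zero    f≗g = refl
  Σ-cong (suc k) f≗g = cong₂ _+F_ (f≗g Fin.zero) (Σ-cong k (f≗g ∘ Fin.suc))

  Σ-zero : ∀ k {f : Fin k → Fin q} → (∀ z → f z ≡ 0#) → Σ k f ≡ 0#
  Σ-zero zero    f≗0 = refl
  Σ-zero (suc k) f≗0 = trans (cong₂ _+F_ (f≗0 Fin.zero) (Σ-zero k (f≗0 ∘ Fin.suc))) (+-identityˡ 0#)

  Σ-+ : ∀ k (f g : Fin k → Fin q) → Σ k (λ z → f z +F g z) ≡ Σ k f +F Σ k g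
  Σ-+ zero    f g = sym (+-identityˡ 0#)
  Σ-+ (suc k) f g = begin
    (f₀ +F g₀) +F Σ k (λ z → f (Fin.suc z) +F g (Fin.suc z)) ≡⟨ cong ((f₀ +F g₀) +F_) (Σ-+ k _ _) ⟩
    (f₀ +F g₀) +F (Σf +F Σg)  ≡⟨ +-assoc f₀ g₀ _ ⟩
    f₀ +F (g₀ +F (Σf +F Σg))  ≡⟨ cong (f₀ +F_) (sym (+-assoc g₀ Σf Σg)) ⟩
    f₀ +F ((g₀ +F Σf) +F Σg)  ≡⟨ cong (λ s → f₀ +F (s +F Σg)) (+-comm g₀ Σf) ⟩
    f₀ +F ((Σf +F g₀) +F Σg)  ≡⟨ cong (f₀ +F_) (+-assoc Σf g₀ Σg) ⟩
    f₀ +F (Σf +F (g₀ +F Σg))  ≡⟨ sym (+-assoc f₀ Σf _) ⟩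
    (f₀ +F Σf) +F (g₀ +F Σg)  ∎
    where
    f₀ = f Fin.zero
    g₀ = g Fin.zero
    Σf = Σ k (f ∘ Fin.suc)
    Σg = Σ k (g ∘ Fin.suc)

  Σ-single : ∀ k (x : Fin k) {f : Fin k → Fin q} → (∀ z → z ≢ x → f z ≡ 0#) → Σ k f ≡ f x
  Σ-single (suc k) Fin.zero    f≗0 = trans (cong (_ +F_) (Σ-zero k (λ z → f≗0 (Fin.suc z) (λ ())))) (+-identityʳ _)
  Σ-single (suc k) (Fin.suc x) f≗0 =
    trans (cong₂ _+F_ (f≗0 Fin.zero (λ ())) (Σ-single k x (λ z z≢x → f≗0 (Fin.suc z) (z≢x ∘ suc-injective))))
          (+-identityˡ _)

  Σ-pair : ∀ k (x y : Fin k) {f : Fin k → Fin q} → x ≢ y →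
           (∀ z → z ≢ x → z ≢ y → f z ≡ 0#) → Σ k f ≡ f x +F f y
  Σ-pair (suc k) Fin.zero Fin.zero x≢y f≗0 = ⊥-elim (x≢y refl)
  Σ-pair (suc k) Fin.zero (Fin.suc y) x≢y f≗0 =
    cong (_ +F_) (Σ-single k y (λ z z≢y → f≗0 (Fin.suc z) (λ ()) (z≢y ∘ suc-injective)))
  Σ-pair (suc k) (Fin.suc x) Fin.zero x≢y f≗0 =
    trans (cong (_ +F_) (Σ-single k x (λ z z≢x → f≗0 (Fin.suc z) (z≢x ∘ suc-injective) (λ ())))) (+-comm _ _)
  Σ-pair (suc k) (Fin.suc x) (Fin.suc y) x≢y f≗0 =
    trans (cong₂ _+F_ (f≗0 Fin.zero (λ ()) (λ ()))
                      (Σ-pair k x y (x≢y ∘ cong Fin.suc)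
                              (λ z z≢x z≢y → f≗0 (Fin.suc z) (z≢x ∘ suc-injective) (z≢y ∘ suc-injective))))
          (+-identityˡ _)

  δ : Fin k → Fin k → Fin q
  δ x z = if does (z ≟ x) then 1# else 0#

  δ-same : (x : Fin k) → δ x x ≡ 1#
  δ-same x rewrite dec-true (x ≟ x) refl = refl

  δ-diff : (x z : Fin k) → z ≢ x → δ x z ≡ 0#
  δ-diff x z z≢x rewrite dec-false (z ≟ x) z≢x = refl

  Σ-δ : ∀ k (x : Fin k) (w : Fin k → Fin q) → Σ k (λ z → δ x z *F w z) ≡ w x
  Σ-δ k x w = trans (Σ-single k x (λ z z≢x → trans (cong (_*F w z) (δ-diff x z z≢x)) (zeroˡ (w z))))
                    (trans (cong (_*F w x) (δ-same x)) (*-identityˡ (w x)))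

  Σ-δ₃ : ∀ k (e f g : Fin k) b (w : Fin k → Fin q) →
         Σ k (λ z → (δ e z +F (δ f z +F (b *F δ g z))) *F w z) ≡ w e +F (w f +F (b *F w g))
  Σ-δ₃ k e f g b w = begin
    Σ k (λ z → (δ e z +F (δ f z +F (b *F δ g z))) *F w z)
      ≡⟨ Σ-cong k expand ⟩
    Σ k (λ z → (δ e z *F w z) +F ((δ f z *F w z) +F (δ g z *F (b *F w z))))
      ≡⟨ Σ-+ k _ _ ⟩
    Σ k (λ z → δ e z *F w z) +F Σ k (λ z → (δ f z *F w z) +F (δ g z *F (b *F w z)))
      ≡⟨ cong (_ +F_) (Σ-+ k _ _) ⟩
    Σ k (λ z → δ e z *F w z) +F (Σ k (λ z → δ f z *F w z) +F Σ k (λ z → δ g z *F (b *F w z)))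
      ≡⟨ cong₂ _+F_ (Σ-δ k e w) (cong₂ _+F_ (Σ-δ k f w) (Σ-δ k g (λ z → b *F w z))) ⟩
    w e +F (w f +F (b *F w g))
      ∎
    where
    expand : ∀ z → (δ e z +F (δ f z +F (b *F δ g z))) *F w z
                 ≡ (δ e z *F w z) +F ((δ f z *F w z) +F (δ g z *F (b *F w z)))
    expand z =
      trans (distribʳ (w z) (δ e z) _) (cong ((δ e z *F w z) +F_)
      (trans (distribʳ (w z) (δ f z) _) (cong ((δ f z *F w z) +F_)
      (trans (cong (_*F w z) (*-comm b (δ g z))) (*-assoc (δ g z) b (w z))))))

module ProjectiveGeometry {q : ℕ} (F : FiniteField q) (n : ℕ) (M : Matroid)
  (v : Fin (Matroid.m M) → Vector F n) (points : IsPGPoints F n v)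
  (linRank : ∀ X → IsLinRank F v X (Matroid.r M X)) where

  open Matroid M
  open FieldFacts F
  open ≡-Reasoning

  parallel⇒≡ : ∀ e f → Parallel F (v e) (v f) → e ≡ f
  parallel⇒≡ = proj₁ (proj₂ points)

  represented : ∀ w → ¬ IsZeroVec F w → ∃ λ e → Parallel F w (v e)
  represented = proj₂ (proj₂ points)

  independent⇒≤rank : ∀ X Y → Y ⊆ X → LinIndep F v Y → ∣ Y ∣ ≤ r X
  independent⇒≤rank X = proj₂ (linRank X)

  leading-zero : ∀ x y a b → x ≢ y → (∀ i → (a *F v x i) +F (b *F v y i) ≡ 0#) → a ≡ 0#
  leading-zero x y a b x≢y rel with a ≟ 0#
  ... | yes a≡0 = a≡0
  ... | no a≢0 = ⊥-elim (x≢y (parallel⇒≡ x y (relation⇒parallel (v x) (v y) a b a≢0 rel)))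

  pair-independent : ∀ x y → x ≢ y → LinIndep F v (⁅ x ⁆ ∪ ⁅ y ⁆)
  pair-independent x y x≢y c c≗0 Σ≡0 = all-zero
    where
    off-pair : ∀ {z} → z ≢ x → z ≢ y → z ∉ ⁅ x ⁆ ∪ ⁅ y ⁆
    off-pair z≢x z≢y z∈ = [ z≢x ∘ ∈⁅⁆⇒≡ , z≢y ∘ ∈⁅⁆⇒≡ ]′ (x∈p∪q⁻ _ _ z∈)
    rel : ∀ i → (c x *F v x i) +F (c y *F v y i) ≡ 0#
    rel i = trans (sym (Σ-pair m x y x≢y (λ z z≢x z≢y →
                    trans (cong (_*F v z i) (c≗0 z (off-pair z≢x z≢y))) (zeroˡ _))))
                  (Σ≡0 i)
    all-zero : ∀ z → c z ≡ 0#
    all-zero z with z ≟ x | z ≟ y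
    ... | yes refl | _ = leading-zero x y (c x) (c y) x≢y rel
    ... | no _ | yes refl = leading-zero y x (c y) (c x) (≢-sym x≢y) (λ i → trans (+-comm _ _) (rel i))
    ... | no z≢x | no z≢y = c≗0 z (off-pair z≢x z≢y)

  simple : ∀ x y → x ≢ y → 2 ≤ r (⁅ x ⁆ ∪ ⁅ y ⁆)
  simple x y x≢y = ≤-trans (∣pair∣≥2 x y x≢y) (independent⇒≤rank _ _ (λ p∈ → p∈) (pair-independent x y x≢y))

  -- The sum of two distinct points is nonzero, hence a multiple of some point g.
  sum-point : ∀ e f → e ≢ f → ∃ λ g → ∃ λ a → ∀ i → v e i +F v f i ≡ a *F v g i
  sum-point e f e≢f = represented (λ i → v e i +F v f i) sum≢0
    where
    sum≢0 : ¬ IsZeroVec F (λ i → v e i +F v f i)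
    sum≢0 sum≡0 = e≢f (parallel⇒≡ e f (-F 1# , λ i →
      trans (inverseˡ-unique _ _ (sum≡0 i)) (sym (-1*x≈-x (v f i)))))

  -- g is neither e (else v_f would be a multiple of v_e) nor, symmetrically, f.
  sum-point-≢ : ∀ e f g a → e ≢ f → (∀ i → v e i +F v f i ≡ a *F v g i) → g ≢ e
  sum-point-≢ e f g a e≢f rel refl = e≢f (sym (parallel⇒≡ f e (a +F (-F 1#) , λ i →
    solve-summand (v e i) (v f i) a (rel i))))

  -- An independent set cannot contain e, f, g with v_e + v_f = a v_g:
  -- the coefficients δ_e + δ_f - a δ_g give a nontrivial relation.
  sum-relation-dependent : ∀ {Y} e f g a → e ≢ f → g ≢ e → (∀ i → v e i +F v f i ≡ a *F v g i) →
                           e ∈ Y → f ∈ Y → g ∈ Y → ¬ LinIndep F v Y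
  sum-relation-dependent {Y} e f g a e≢f g≢e rel e∈Y f∈Y g∈Y indep =
    0≢1 (sym (trans (sym c-e≡1) (indep c c-off Σ≡0 e)))
    where
    c : Fin m → Fin q
    c z = δ e z +F (δ f z +F ((-F a) *F δ g z))
    vanish : 0# +F ((-F a) *F 0#) ≡ 0#
    vanish = trans (+-identityˡ _) (zeroʳ _)
    c-off : ∀ z → z ∉ Y → c z ≡ 0#
    c-off z z∉Y = begin
      c z                              ≡⟨ cong₂ _+F_ (δ-diff e z (≢ e∈Y))
                                            (cong₂ _+F_ (δ-diff f z (≢ f∈Y)) (cong ((-F a) *F_) (δ-diff g z (≢ g∈Y)))) ⟩
      0# +F (0# +F ((-F a) *F 0#))     ≡⟨ trans (cong (0# +F_) vanish) (+-identityˡ 0#) ⟩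
      0#                               ∎
      where
      ≢ : ∀ {p} → p ∈ Y → z ≢ p
      ≢ p∈Y refl = z∉Y p∈Y
    c-e≡1 : c e ≡ 1#
    c-e≡1 = begin
      c e                              ≡⟨ cong₂ _+F_ (δ-same e)
                                            (cong₂ _+F_ (δ-diff f e e≢f) (cong ((-F a) *F_) (δ-diff g e (≢-sym g≢e)))) ⟩
      1# +F (0# +F ((-F a) *F 0#))     ≡⟨ trans (cong (1# +F_) vanish) (+-identityʳ 1#) ⟩
      1#                               ∎
    Σ≡0 : ∀ i → Σ m (λ z → c z *F v z i) ≡ 0#
    Σ≡0 i = begin
      Σ m (λ z → c z *F v z i)                     ≡⟨ Σ-δ₃ m e f g (-F a) (λ z → v z i) ⟩
      v e i +F (v f i +F ((-F a) *F v g i))        ≡⟨ sym (+-assoc _ _ _) ⟩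
      (v e i +F v f i) +F ((-F a) *F v g i)        ≡⟨ cong₂ _+F_ (rel i) (sym (-‿distribˡ-* a (v g i))) ⟩
      (a *F v g i) +F (-F (a *F v g i))            ≡⟨ -‿inverseʳ _ ⟩
      0#                                           ∎

  -- Hence {e, f, g} has rank ≤ 2: an independent subset of rank ≥ 3 would be all of it.
  collinear-rank : ∀ e f g a → e ≢ f → g ≢ e → (∀ i → v e i +F v f i ≡ a *F v g i) →
                   r (Tri e f g) ≤ 2
  collinear-rank e f g a e≢f g≢e rel with 3 ≤? r (Tri e f g)
  ... | no r≱3 = ≤-pred (≰⇒> r≱3)
  ... | yes 3≤r with proj₁ (linRank (Tri e f g))
  ...   | Y , Y⊆T , indep , ∣Y∣≡r =
    ⊥-elim (sum-relation-dependent e f g a e≢f g≢e rel (in-Y e∈Tri) (in-Y f∈Tri) (in-Y g∈Tri) indep)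
    where
    in-Y : ∀ {p} → p ∈ Tri e f g → p ∈ Y
    in-Y = ⊆-full Y⊆T (≤-trans (∣Tri∣≤3 {e = e} {f} {g}) (≤-trans 3≤r (≤-reflexive (sym ∣Y∣≡r))))

  thick : ∀ e f → e ≢ f → ThirdPoint M e f
  thick e f e≢f with sum-point e f e≢f
  ... | g , a , rel = record
    { point = g
    ; e≢f = e≢f
    ; point≢e = g≢e
    ; point≢f = sum-point-≢ f e g a (≢-sym e≢f) (λ i → trans (+-comm _ _) (rel i))
    ; collinear = collinear-rank e f g a e≢f g≢e rel
    }
    where
    g≢e : g ≢ e
    g≢e = sum-point-≢ e f g a e≢f rel

  record CoordinatePoint (j : Fin n) : Set where
    field
      point : Fin m
      on : v point j ≢ 0#
      off : ∀ i → i ≢ j → v point i ≡ 0#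

  unit≢0 : (j : Fin n) → ¬ IsZeroVec F (δ j)
  unit≢0 j δj≡0 = 0≢1 (sym (trans (sym (δ-same j)) (δj≡0 j)))

  -- The point representing the unit vector δ_j = a v_e is supported at j,
  -- and 1 = δ_j(j) = a v_e(j) makes both a and v_e(j) nonzero.
  coordinate-point : ∀ j → CoordinatePoint j
  coordinate-point j with represented (δ j) (unit≢0 j)
  ... | e , a , unit≡av = record { point = e ; on = on ; off = off }
    where
    diagonal : 1# ≡ a *F v e j
    diagonal = trans (sym (δ-same j)) (unit≡av j)
    a≢0 : a ≢ 0#
    a≢0 a≡0 = 0≢1 (sym (trans diagonal (trans (cong (_*F v e j) a≡0) (zeroˡ _))))
    on : v e j ≢ 0#
    on vej≡0 = 0≢1 (sym (trans diagonal (trans (cong (a *F_) vej≡0) (zeroʳ _))))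
    off : ∀ i → i ≢ j → v e i ≡ 0#
    off i i≢j = nonzero-cancel a (v e i) a≢0 (trans (sym (unit≡av i)) (δ-diff j i i≢j))

  -- The n coordinate points are distinct and independent, so r(M) ≥ n.
  n≤rank : n ≤ rM M
  n≤rank = ≤-trans (Im-size axis axis-injective) (independent⇒≤rank ⊤ (Im axis) (λ _ → ∈⊤) axes-independent)
    where
    open CoordinatePoint
    axis : Fin n → Fin m
    axis j = point (coordinate-point j)
    axis-on : ∀ j → v (axis j) j ≢ 0#
    axis-on j = on (coordinate-point j)
    axis-off : ∀ j i → i ≢ j → v (axis j) i ≡ 0#
    axis-off j = off (coordinate-point j)
    axis-injective : ∀ i j → axis i ≡ axis j → i ≡ j
    axis-injective i j axis-i≡axis-j with i ≟ j
    ... | yes i≡j = i≡j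
    ... | no i≢j = ⊥-elim (axis-on i (trans (cong (λ e → v e i) axis-i≡axis-j) (axis-off j i i≢j)))
    -- In coordinate j only the term of axis j survives, so its coefficient is 0.
    axes-independent : LinIndep F v (Im axis)
    axes-independent c c≗0 Σ≡0 z with z ∈? Im axis
    ... | no z∉ = c≗0 z z∉
    ... | yes z∈ with Im-elim axis z∈
    ...   | j , refl = nonzero-cancel (v (axis j) j) (c (axis j)) (axis-on j)
                         (trans (*-comm _ _) (trans (sym (Σ-single m (axis j) others)) (Σ≡0 j)))
      where
      others : ∀ z′ → z′ ≢ axis j → c z′ *F v z′ j ≡ 0#
      others z′ z′≢ with z′ ∈? Im axis
      ... | no z′∉ = trans (cong (_*F _) (c≗0 z′ z′∉)) (zeroˡ _)
      ... | yes z′∈ with Im-elim axis z′∈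
      ...   | j′ , refl = trans (cong (c (axis j′) *F_) (axis-off j′ j (λ j≡j′ → z′≢ (cong axis (sym j≡j′)))))
                                (zeroʳ _)

lemma6p3 : (q : ℕ) → IsPrimePower q → (F : FiniteField q) →
           (n : ℕ) → 1 ≤ n → (M : Matroid) → IsPG M n F →
           IsTangle M n (𝒯 M n)
lemma6p3 q _ F n _ M (v , points , linRank) = ThickMatroid.tangle M n simple thick n≤rank
  where open ProjectiveGeometry F n M v points linRank
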